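{- Let $G$ be a complete $k$-partite graph (all $k$ parts nonempty) on $n$ vertices, and let $n'$ be the number of vertices in its largest part. Then $\eta(G)=\min\left\{\left\lfloor\tfrac{1}{2}(n+k)\right\rfloor,\ n-n'+1\right\}$.
   Context: All graphs are finite, simple and undirected. A graph $H$ is a minor of $G$ if $H$ can be obtained from a subgraph of $G$ by contracting edges. The Hadwiger number $\eta(G)$ is the maximum $t$ such that the complete graph $K_t$ is a minor of $G$. -}

module Defs where

open import Data.Nat using (ℕ; _⊔_)
open import Data.Fin using (Fin; _≟_)
open import Data.List using (List; length; filter; map; foldr; allFin)
open import Data.Maybe using (Maybe; just)
open import Data.Product using (Σ; ∃; _×_)
open import Relation.Binary.PropositionalEquality using (_≡_; _≢_)
open import Relation.Nullary using (¬_)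

record Graph (n : ℕ) : Set₁ where
  field
    Adj     : Fin n → Fin n → Set
    symAdj  : ∀ {u v} → Adj u v → Adj v u
    irrefl  : ∀ {u} → ¬ Adj u u
open Graph public

data PathIn {n : ℕ} (G : Graph n) (S : Fin n → Set) : Fin n → Fin n → Set where
  here : ∀ {u} → S u → PathIn G S u u
  step : ∀ {u w v} → S u → Adj G u w → PathIn G S w v → PathIn G S u v

-- K_t is a minor of G: a model of K_t in G, i.e. t pairwise disjoint nonempty
-- connected branch sets (β v ≡ just i means v lies in branch set i), every two
-- distinct of which are joined by an edge.
KMinor : {n : ℕ} → Graph n → ℕ → Set
KMinor {n} G t =
  Σ (Fin n → Maybe (Fin t)) λ β →
    (∀ i → ∃ λ v → β v ≡ just i)
    × (∀ i u v → β u ≡ just i → β v ≡ just i → PathIn G (λ w → β w ≡ just i) u v)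
    × (∀ i j → i ≢ j → ∃ λ u → ∃ λ v → β u ≡ just i × β v ≡ just j × Adj G u v)

HadwigerNumber : {n : ℕ} → Graph n → ℕ → Set
HadwigerNumber G m = KMinor G m × (∀ t → KMinor G t → t Data.Nat.≤ m)

-- Complete multipartite graph on Fin n with parts c⁻¹(i), i : Fin k.
completeMultipartite : {n k : ℕ} → (Fin n → Fin k) → Graph n
completeMultipartite c = record
  { Adj = λ u v → c u ≢ c v
  ; symAdj = λ p q → p (Relation.Binary.PropositionalEquality.sym q)
  ; irrefl = λ p → p Relation.Binary.PropositionalEquality.refl
  }

Surjective : {n k : ℕ} → (Fin n → Fin k) → Set
Surjective {n} {k} c = ∀ (i : Fin k) → ∃ λ (v : Fin n) → c v ≡ i

partSize : {n k : ℕ} → (Fin n → Fin k) → Fin k → ℕ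
partSize {n} c i = length (filter (λ v → c v ≟ i) (allFin n))

largestPart : {n k : ℕ} → (Fin n → Fin k) → ℕ
largestPart {n} {k} c = foldr _⊔_ 0 (map (partSize c) (allFin k))

{-# OPTIONS --safe #-}
-- Upper bound: in a K_t model give every branch set two distinct tokens among the n vertices
-- and the k colours, namely one of its vertices and, besides, a second vertex or else (for a
-- singleton) its colour; two singletons of one colour are not adjacent, so 2t ≤ n + k.
-- Likewise at most one branch set lies inside a largest part and every other one has a vertex
-- outside it, so t + n′ ≤ n + 1.
-- Lower bound: keep one representative per part as k singleton branch sets, list the other
-- N = n − k vertices part by part, and pair the entries at positions j and j + s, where
-- s = max(n′ − 1, ⌈N/2⌉). A part occupies at most n′ − 1 consecutive positions, so every pair
-- is two-coloured and hence adjacent to every other branch set: this is a model of K_(k + N − s).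
module Submission where

open import Defs
open import Data.Nat using (ℕ; zero; suc; _+_; _∸_; _⊓_; _⊔_; ⌊_/2⌋; ⌈_/2⌉; _≤_; _<_; z≤n; s≤s; _<?_)
open import Data.Nat.Properties hiding (_≟_)
open import Data.Fin using (Fin; zero; suc; toℕ; fromℕ<; splitAt; join; inject≤; _≟_)
open import Data.Fin.Properties
  using (toℕ-injective; toℕ-fromℕ<; toℕ<n; toℕ-inject≤; splitAt-join; join-splitAt; injective⇒≤; any?)
open import Data.List using (List; []; _∷_; _++_; length; lookup; filter; allFin; foldr; map; concatMap)
open import Data.List.Membership.Propositional using (_∈_)
open import Data.List.Membership.Propositional.Properties
  using (∈-lookup; ∈-filter⁺; ∈-filter⁻; ∈-allFin; ∈-map⁺; ∈-concat⁺′)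
open import Data.List.Relation.Unary.All as All using (All; []; _∷_)
import Data.List.Relation.Unary.All.Properties as Allₚ
open import Data.List.Relation.Unary.Any using (here; there; index)
open import Data.List.Relation.Unary.Any.Properties using (lookup-index)
import Data.List.Relation.Unary.AllPairs as AllPairs
import Data.List.Relation.Unary.AllPairs.Properties as AllPairsₚ
open import Data.List.Relation.Unary.Unique.Propositional using (Unique; _∷_)
import Data.List.Relation.Unary.Unique.Propositional.Properties as Uniqueₚ
open import Data.List.Properties using (foldr-preservesᵇ; length-filter; length-tabulate)
open import Data.Maybe using (Maybe; just; nothing; _>>=_)
import Data.Maybe as Maybe
open import Data.Maybe.Properties using (just-injective; ≡-dec)
open import Data.Product using (Σ; ∃; ∃₂; _×_; _,_; proj₁; proj₂)
open import Data.Sum using (_⊎_; inj₁; inj₂)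
open import Data.Sum.Properties using (inj₁-injective; inj₂-injective)
open import Function using (_∘_; id; Injective)
open import Relation.Binary.PropositionalEquality
open import Relation.Nullary using (¬_; Dec; yes; no; contradiction; ¬?; _×-dec_)
open import Relation.Unary using (Decidable)


CliqueModel : {n : ℕ} → Graph n → Set → Set
CliqueModel {n} G I =
  Σ (Fin n → Maybe I) λ β →
    (∀ i → ∃ λ v → β v ≡ just i)
    × (∀ i u v → β u ≡ just i → β v ≡ just i → PathIn G (λ w → β w ≡ just i) u v)
    × (∀ i j → i ≢ j → ∃ λ u → ∃ λ v → β u ≡ just i × β v ≡ just j × Adj G u v)

PathIn-map : ∀ {n} {G : Graph n} {S T : Fin n → Set} → (∀ {w} → S w → T w) →
  ∀ {u v} → PathIn G S u v → PathIn G T u v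
PathIn-map f (here s)       = here (f s)
PathIn-map f (step s uw wv) = step (f s) uw (PathIn-map f wv)

reindex : ∀ {n} {G : Graph n} {I J : Set} (h : J → Maybe I) →
  (∀ i → ∃ λ j → h j ≡ just i) →
  (∀ {i j j′} → h j ≡ just i → h j′ ≡ just i → j ≡ j′) →
  CliqueModel G J → CliqueModel G I
reindex {n} {G} {I} h h-onto h-inj (β , nonempty , connected , adjacent) =
  β′ , nonempty′ , connected′ , adjacent′
  where
  β′ : Fin n → Maybe I
  β′ v = β v >>= h

  lift : ∀ {v i j} → β v ≡ just j → h j ≡ just i → β′ v ≡ just i
  lift βv hj rewrite βv = hj

  unlift : ∀ v {i} → β′ v ≡ just i → ∃ λ j → β v ≡ just j × h j ≡ just i
  unlift v eq with β v
  unlift v () | nothing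
  unlift v eq | just j = j , refl , eq

  nonempty′ : ∀ i → ∃ λ v → β′ v ≡ just i
  nonempty′ i with h-onto i
  ... | j , hj with nonempty j
  ...   | v , βv = v , lift βv hj

  connected′ : ∀ i u v → β′ u ≡ just i → β′ v ≡ just i → PathIn G (λ w → β′ w ≡ just i) u v
  connected′ i u v βu βv with unlift u βu | unlift v βv
  ... | j , βu′ , hj | j′ , βv′ , hj′ with refl ← h-inj hj hj′ =
    PathIn-map (λ βw → lift βw hj) (connected j u v βu′ βv′)

  adjacent′ : ∀ i i′ → i ≢ i′ → ∃ λ u → ∃ λ v → β′ u ≡ just i × β′ v ≡ just i′ × Adj G u v
  adjacent′ i i′ i≢i′ with h-onto i | h-onto i′
  ... | j , hj | j′ , hj′ with adjacent j j′ (λ { refl → i≢i′ (just-injective (trans (sym hj) hj′)) })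
  ...   | u , v , βu , βv , uv = u , v , lift βu hj , lift βv hj′ , uv

join-injective : ∀ a b → Injective _≡_ _≡_ (join a b)
join-injective a b {x} {y} eq = begin
  x                        ≡⟨ splitAt-join a b x ⟨
  splitAt a (join a b x)   ≡⟨ cong (splitAt a) eq ⟩
  splitAt a (join a b y)   ≡⟨ splitAt-join a b y ⟩
  y                        ∎
  where open ≡-Reasoning

splitAt-injective : ∀ a b → Injective _≡_ _≡_ (splitAt a {b})
splitAt-injective a b {x} {y} eq = begin
  x                        ≡⟨ join-splitAt a b x ⟨
  join a b (splitAt a x)   ≡⟨ cong (join a b) eq ⟩
  join a b (splitAt a y)   ≡⟨ join-splitAt a b y ⟩
  y                        ∎
  where open ≡-Reasoning

maybeFin : (m : ℕ) → ℕ → Maybe (Fin m)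
maybeFin m a with a <? m
... | yes a<m = just (fromℕ< a<m)
... | no _    = nothing

maybeFin-toℕ : ∀ {m} (i : Fin m) → maybeFin m (toℕ i) ≡ just i
maybeFin-toℕ {m} i with toℕ i <? m
... | yes i<m = cong just (toℕ-injective (toℕ-fromℕ< i<m))
... | no i≮m  = contradiction (toℕ<n i) i≮m

maybeFin-just : ∀ {m a} {i : Fin m} → maybeFin m a ≡ just i → toℕ i ≡ a
maybeFin-just {m} {a} eq with a <? m
maybeFin-just refl | yes a<m = toℕ-fromℕ< a<m
maybeFin-just ()   | no _

kMinor-⊎ : ∀ {n} {G : Graph n} {a b} → CliqueModel G (Fin a ⊎ Fin b) → KMinor G (a + b)
kMinor-⊎ {a = a} {b} = reindex (just ∘ join a b)
  (λ i → splitAt a i , cong just (join-splitAt a b i))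
  (λ hj hj′ → join-injective a b (just-injective (trans hj (sym hj′))))

kMinor-≤ : ∀ {n} {G : Graph n} {m t} → m ≤ t → KMinor G t → KMinor G m
kMinor-≤ {m = m} {t} m≤t = reindex (maybeFin m ∘ toℕ {t})
  (λ i → inject≤ i m≤t , trans (cong (maybeFin m) (toℕ-inject≤ i m≤t)) (maybeFin-toℕ i))
  (λ hj hj′ → toℕ-injective (trans (sym (maybeFin-just hj)) (maybeFin-just hj′)))

injective⇒≤-⊎ : ∀ {a b c} {f : Fin a → Fin b ⊎ Fin c} → Injective _≡_ _≡_ f → a ≤ b + c
injective⇒≤-⊎ {b = b} {c} f-inj = injective⇒≤ (f-inj ∘ join-injective b c)

⊎-injective⇒≤ : ∀ {a b c d} {f : Fin a ⊎ Fin b → Fin c ⊎ Fin d} → Injective _≡_ _≡_ f → a + b ≤ c + d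
⊎-injective⇒≤ {a} {b} f-inj = injective⇒≤-⊎ (splitAt-injective a b ∘ f-inj)

module _ {A : Set} where

  nth : List A → ℕ → Maybe A
  nth []       _       = nothing
  nth (x ∷ xs) zero    = just x
  nth (x ∷ xs) (suc a) = nth xs a

  nth-∈ : ∀ {xs a v} → nth xs a ≡ just v → v ∈ xs
  nth-∈ {x ∷ xs} {zero}  refl = here refl
  nth-∈ {x ∷ xs} {suc a} eq   = there (nth-∈ eq)

  nth-just : ∀ {xs a} → a < length xs → ∃ λ v → nth xs a ≡ just v
  nth-just {x ∷ xs} {zero}  _         = x , refl
  nth-just {x ∷ xs} {suc a} (s≤s a<n) = nth-just {xs} a<n

  nth-lookup : ∀ xs (i : Fin (length xs)) → nth xs (toℕ i) ≡ just (lookup xs i)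
  nth-lookup (x ∷ xs) zero    = refl
  nth-lookup (x ∷ xs) (suc i) = nth-lookup xs i

  nth-index : ∀ {xs v} (v∈xs : v ∈ xs) → nth xs (toℕ (index v∈xs)) ≡ just v
  nth-index {xs} v∈xs = trans (nth-lookup xs (index v∈xs)) (cong just (sym (lookup-index v∈xs)))

  nth-injective : ∀ {xs a b v} → Unique xs → nth xs a ≡ just v → nth xs b ≡ just v → a ≡ b
  nth-injective {x ∷ xs} {zero}  {zero}  _       _    _    = refl
  nth-injective {x ∷ xs} {zero}  {suc b} u       refl xb   = contradiction (nth-∈ xb) (Uniqueₚ.Unique[x∷xs]⇒x∉xs u)
  nth-injective {x ∷ xs} {suc a} {zero}  u       xa   refl = contradiction (nth-∈ xa) (Uniqueₚ.Unique[x∷xs]⇒x∉xs u)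
  nth-injective {x ∷ xs} {suc a} {suc b} (_ ∷ u) xa   xb   = cong suc (nth-injective u xa xb)

module _ {X C : Set} (col : X → C) where

  Separated : ℕ → List X → Set
  Separated B xs = ∀ a d {u v} → nth xs a ≡ just u → nth xs (a + d) ≡ just v → col u ≡ col v → d < B

  nth-++-colour : ∀ {i} xs {ys d v} → All (λ y → col y ≢ i) ys →
    nth (xs ++ ys) d ≡ just v → col v ≡ i → d < length xs
  nth-++-colour []                         ys≢i hv colv = contradiction colv (All.lookup ys≢i (nth-∈ hv))
  nth-++-colour (x ∷ xs)      {d = zero}  _    _  _    = s≤s z≤n
  nth-++-colour (x ∷ xs) {ys} {d = suc d} ys≢i hv colv = s≤s (nth-++-colour xs {ys} ys≢i hv colv)

  ++-separated : ∀ {i B xs ys} → All (λ x → col x ≡ i) xs → length xs ≤ B →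
    All (λ y → col y ≢ i) ys → Separated B ys → Separated B (xs ++ ys)
  ++-separated []                         _   _    ys-sep = ys-sep
  ++-separated {xs = x ∷ xs} (colx ∷ _) len ys≢i _ zero d refl hv colx≡colv =
    <-≤-trans (nth-++-colour (x ∷ xs) ys≢i hv (trans (sym colx≡colv) colx)) len
  ++-separated (_ ∷ xs≡i) len ys≢i ys-sep (suc a) d hu hv =
    ++-separated xs≡i (≤-trans (n≤1+n _) len) ys≢i ys-sep a d hu hv

  concatMap-separated : ∀ {B} (bl : C → List X) → (∀ i → All (λ x → col x ≡ i) (bl i)) →
    (∀ i → length (bl i) ≤ B) → ∀ {is} → Unique is → Separated B (concatMap bl is)
  concatMap-separated bl bl≡ bl≤ {[]}     _ _ _ ()
  concatMap-separated bl bl≡ bl≤ {i ∷ is} u@(_ ∷ u′) =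
    ++-separated (bl≡ i) (bl≤ i) rest≢i (concatMap-separated bl bl≡ bl≤ u′)
    where
    rest≢i : All (λ x → col x ≢ i) (concatMap bl is)
    rest≢i = Allₚ.concat⁺ (Allₚ.map⁺ (All.tabulate λ j∈is →
      All.map (λ colx≡j colx≡i → Uniqueₚ.Unique[x∷xs]⇒x∉xs u (subst (_∈ is) (trans (sym colx≡j) colx≡i) j∈is)) (bl≡ _)))

∈⇒≤foldr-⊔ : ∀ {m ms} → m ∈ ms → m ≤ foldr _⊔_ 0 ms
∈⇒≤foldr-⊔              (here refl) = m≤m⊔n _ _
∈⇒≤foldr-⊔ {ms = m′ ∷ _} (there m∈) = m≤n⇒m≤o⊔n m′ (∈⇒≤foldr-⊔ m∈)

module _ {n k : ℕ} (c : Fin n → Fin k) where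

  part : Fin k → List (Fin n)
  part i = filter (λ v → c v ≟ i) (allFin n)

  ∈-part⁺ : ∀ {v i} → c v ≡ i → v ∈ part i
  ∈-part⁺ {i = i} = ∈-filter⁺ (λ v → c v ≟ i) (∈-allFin _)

  ∈-part⁻ : ∀ {v i} → v ∈ part i → c v ≡ i
  ∈-part⁻ {i = i} v∈ = proj₂ (∈-filter⁻ (λ v → c v ≟ i) {xs = allFin n} v∈)

  part-unique : ∀ i → Unique (part i)
  part-unique i = Uniqueₚ.filter⁺ (λ v → c v ≟ i) (Uniqueₚ.allFin⁺ n)

  partSize≤n : ∀ i → partSize c i ≤ n
  partSize≤n i = ≤-trans (length-filter (λ v → c v ≟ i) (allFin n)) (≤-reflexive (length-tabulate id))

  partSize≤largestPart : ∀ i → partSize c i ≤ largestPart c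
  partSize≤largestPart i = ∈⇒≤foldr-⊔ (∈-map⁺ (partSize c) (∈-allFin i))

  largestPart-lub : ∀ {m} → (∀ i → partSize c i ≤ m) → largestPart c ≤ m
  largestPart-lub {m} bound = foldr-preservesᵇ {P = _≤ m} ⊔-lub z≤n (Allₚ.map⁺ (Allₚ.tabulate⁺ bound))

  largestPart≤n : largestPart c ≤ n
  largestPart≤n = largestPart-lub partSize≤n

module UpperBound {n k : ℕ} (c : Fin n → Fin k) {t : ℕ} (K : KMinor (completeMultipartite c) t) where

  β : Fin n → Maybe (Fin t)
  β = proj₁ K

  x : Fin t → Fin n
  x i = proj₁ (proj₁ (proj₂ K) i)

  β-x : ∀ i → β (x i) ≡ just i
  β-x i = proj₂ (proj₁ (proj₂ K) i)

  branch-unique : ∀ {u i j} → β u ≡ just i → β u ≡ just j → i ≡ j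
  branch-unique βu βu′ = just-injective (trans (sym βu) βu′)

  x-injective : Injective _≡_ _≡_ x
  x-injective {i} {j} xi≡xj = branch-unique (β-x i) (subst (λ v → β v ≡ just j) (sym xi≡xj) (β-x j))

  t≤n : t ≤ n
  t≤n = injective⇒≤ x-injective

  InPart : Fin t → Fin k → Set
  InPart i p = ∀ u → β u ≡ just i → c u ≡ p

  -- Two branch sets inside one part are not adjacent.
  inPart-unique : ∀ {i j p} → InPart i p → InPart j p → i ≡ j
  inPart-unique {i} {j} i⊆p j⊆p with i ≟ j
  ... | yes i≡j = i≡j
  ... | no i≢j with proj₂ (proj₂ (proj₂ K)) i j i≢j
  ...   | u , v , βu , βv , cu≢cv = contradiction (trans (i⊆p u βu) (sym (j⊆p v βv))) cu≢cv

  Meets : Fin t → (Fin n → Set) → Set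
  Meets i P = ∃ λ u → β u ≡ just i × P u

  meets? : ∀ {P} → Decidable P → ∀ i → Dec (Meets i P)
  meets? P? i = any? (λ u → ≡-dec _≟_ (β u) (just i) ×-dec P? u)

  second : ∀ i → Dec (Meets i (_≢ x i)) → Fin n ⊎ Fin k
  second i (yes (y , _)) = inj₁ y
  second i (no _)        = inj₂ (c (x i))

  singleton-inPart : ∀ i → ¬ Meets i (_≢ x i) → InPart i (c (x i))
  singleton-inPart i no-second u βu with u ≟ x i
  ... | yes u≡xi = cong c u≡xi
  ... | no u≢xi  = contradiction (u , βu , u≢xi) no-second

  second-injective : ∀ i j di dj → second i di ≡ second j dj → i ≡ j
  second-injective i j (yes (y , βy , _)) (yes (_ , βy′ , _)) refl = branch-unique βy βy′
  second-injective i j (no ¬i) (no ¬j) eq =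
    inPart-unique (singleton-inPart i ¬i) (subst (InPart j) (sym (inj₂-injective eq)) (singleton-inPart j ¬j))

  x≢second : ∀ i j dj → inj₁ (x i) ≢ second j dj
  x≢second i j (yes (y , βy , y≢xj)) refl with refl ← branch-unique (β-x i) βy = y≢xj refl

  doubled : Fin t ⊎ Fin t → Fin n ⊎ Fin k
  doubled (inj₁ i) = inj₁ (x i)
  doubled (inj₂ i) = second i (meets? (λ u → ¬? (u ≟ x i)) i)

  doubled-injective : Injective _≡_ _≡_ doubled
  doubled-injective {inj₁ i} {inj₁ j} eq = cong inj₁ (x-injective (inj₁-injective eq))
  doubled-injective {inj₁ i} {inj₂ j} eq = contradiction eq (x≢second i j _)
  doubled-injective {inj₂ i} {inj₁ j} eq = contradiction (sym eq) (x≢second j i _)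
  doubled-injective {inj₂ i} {inj₂ j} eq = cong inj₂ (second-injective i j _ _ eq)

  t≤⌊n+k/2⌋ : t ≤ ⌊ n + k /2⌋
  t≤⌊n+k/2⌋ = subst (_≤ ⌊ n + k /2⌋) (sym (n≡⌊n+n/2⌋ t)) (⌊n/2⌋-mono (⊎-injective⇒≤ doubled-injective))

  module _ (p : Fin k) where

    escape : ∀ i → Dec (Meets i (λ u → c u ≢ p)) → Fin n ⊎ Fin 1
    escape i (yes (y , _)) = inj₁ y
    escape i (no _)        = inj₂ zero

    inside-inPart : ∀ i → ¬ Meets i (λ u → c u ≢ p) → InPart i p
    inside-inPart i inside u βu with c u ≟ p
    ... | yes cu≡p = cu≡p
    ... | no cu≢p  = contradiction (u , βu , cu≢p) inside

    escape-injective : ∀ i j di dj → escape i di ≡ escape j dj → i ≡ j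
    escape-injective i j (yes (y , βy , _)) (yes (_ , βy′ , _)) refl = branch-unique βy βy′
    escape-injective i j (no ¬i) (no ¬j) _ = inPart-unique (inside-inPart i ¬i) (inside-inPart j ¬j)

    escape≢part : ∀ i di q → escape i di ≢ inj₁ (lookup (part c p) q)
    escape≢part i (yes (y , _ , cy≢p)) q refl = cy≢p (∈-part⁻ c (∈-lookup q))

    memberOrEscape : Fin (partSize c p) ⊎ Fin t → Fin n ⊎ Fin 1
    memberOrEscape (inj₁ q) = inj₁ (lookup (part c p) q)
    memberOrEscape (inj₂ i) = escape i (meets? (λ u → ¬? (c u ≟ p)) i)

    memberOrEscape-injective : Injective _≡_ _≡_ memberOrEscape
    memberOrEscape-injective {inj₁ q} {inj₁ q′} eq = cong inj₁ (toℕ-injective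
      (nth-injective (part-unique c p) (nth-lookup (part c p) q)
        (trans (nth-lookup (part c p) q′) (cong just (sym (inj₁-injective eq))))))
    memberOrEscape-injective {inj₁ q} {inj₂ i} eq = contradiction (sym eq) (escape≢part i _ q)
    memberOrEscape-injective {inj₂ i} {inj₁ q} eq = contradiction eq (escape≢part i _ q)
    memberOrEscape-injective {inj₂ i} {inj₂ j} eq = cong inj₂ (escape-injective i j _ _ eq)

    partSize+t≤n+1 : partSize c p + t ≤ n + 1
    partSize+t≤n+1 = ⊎-injective⇒≤ memberOrEscape-injective

  t≤n∸largestPart+1 : t ≤ n ∸ largestPart c + 1
  t≤n∸largestPart+1 = begin
    t                        ≤⟨ m+n≤o⇒m≤o∸n t (subst (_≤ n + 1) (+-comm (largestPart c) t) largest+t≤n+1) ⟩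
    (n + 1) ∸ largestPart c  ≡⟨ +-∸-comm 1 (largestPart≤n c) ⟩
    n ∸ largestPart c + 1    ∎
    where
    open ≤-Reasoning
    largest+t≤n+1 : largestPart c + t ≤ n + 1
    largest+t≤n+1 = m≤o∸n⇒m+n≤o (largestPart c) (m≤n⇒m≤n+o 1 t≤n)
      (largestPart-lub c (λ p → m+n≤o⇒m≤o∸n (partSize c p) (partSize+t≤n+1 p)))

module TransversalModel {n k : ℕ} (c : Fin n → Fin k) {J : Set} (β : Fin n → Maybe (Fin k ⊎ J))
  (r : Fin k → Fin n) (c-r : ∀ i → c (r i) ≡ i)
  (β-r : ∀ i → β (r i) ≡ just (inj₁ i)) (β-inj₁ : ∀ {u i} → β u ≡ just (inj₁ i) → u ≡ r i)
  (x y : J → Fin n) (β-x : ∀ j → β (x j) ≡ just (inj₂ j)) (β-y : ∀ j → β (y j) ≡ just (inj₂ j))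
  (c-x≢c-y : ∀ j → c (x j) ≢ c (y j)) where

  G : Graph n
  G = completeMultipartite c

  -- Every vertex has a neighbour in a two-coloured branch set.
  avoid : ∀ j p → ∃ λ w → β w ≡ just (inj₂ j) × c w ≢ p
  avoid j p with c (x j) ≟ p
  ... | no cx≢p  = x j , β-x j , cx≢p
  ... | yes cx≡p = y j , β-y j , λ cy≡p → c-x≢c-y j (trans cx≡p (sym cy≡p))

  nonempty : ∀ b → ∃ λ v → β v ≡ just b
  nonempty (inj₁ i) = r i , β-r i
  nonempty (inj₂ j) = x j , β-x j

  connected : ∀ b u v → β u ≡ just b → β v ≡ just b → PathIn G (λ w → β w ≡ just b) u v
  connected (inj₁ i) u v βu βv with refl ← β-inj₁ βu | refl ← β-inj₁ βv = here βu
  connected (inj₂ j) u v βu βv with c u ≟ c v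
  ... | no cu≢cv = step βu cu≢cv (here βv)
  ... | yes cu≡cv with avoid j (c u)
  ...   | w , βw , cw≢cu =
    step βu (cw≢cu ∘ sym) (step βw (λ cw≡cv → cw≢cu (trans cw≡cv (sym cu≡cv))) (here βv))

  adjacent : ∀ b b′ → b ≢ b′ → ∃ λ u → ∃ λ v → β u ≡ just b × β v ≡ just b′ × Adj G u v
  adjacent (inj₁ i) (inj₁ i′) b≢b′ =
    r i , r i′ , β-r i , β-r i′ , λ eq → b≢b′ (cong inj₁ (trans (sym (c-r i)) (trans eq (c-r i′))))
  adjacent (inj₁ i) (inj₂ j) _ with avoid j i
  ... | w , βw , cw≢i = r i , w , β-r i , βw , λ eq → cw≢i (trans (sym eq) (c-r i))
  adjacent (inj₂ j) (inj₁ i) _ with avoid j i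
  ... | w , βw , cw≢i = w , r i , βw , β-r i , λ eq → cw≢i (trans eq (c-r i))
  adjacent (inj₂ j) (inj₂ j′) _ with avoid j′ (c (x j))
  ... | w , βw , cw≢cx = x j , w , β-x j , βw , cw≢cx ∘ sym

  model : CliqueModel G (Fin k ⊎ J)
  model = β , nonempty , connected , adjacent

-- Both j and j + s are sent to j, for j < m ≤ s.
pairIndex : (m s : ℕ) → ℕ → Maybe (Fin m)
pairIndex m s a with a <? s
... | yes _ = maybeFin m a
... | no _  = maybeFin m (a ∸ s)

pairIndex-low : ∀ {m s} → m ≤ s → (j : Fin m) → pairIndex m s (toℕ j) ≡ just j
pairIndex-low {m} {s} m≤s j with toℕ j <? s
... | yes _   = maybeFin-toℕ j
... | no j≮s  = contradiction (<-≤-trans (toℕ<n j) m≤s) j≮s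

pairIndex-high : ∀ {m} s (j : Fin m) → pairIndex m s (toℕ j + s) ≡ just j
pairIndex-high {m} s j with toℕ j + s <? s
... | yes j+s<s = contradiction j+s<s (m+n≮n (toℕ j) s)
... | no _      = trans (cong (maybeFin m) (m+n∸n≡m (toℕ j) s)) (maybeFin-toℕ j)

⌊m+m+n/2⌋≡m+⌊n/2⌋ : ∀ m n → ⌊ m + m + n /2⌋ ≡ m + ⌊ n /2⌋
⌊m+m+n/2⌋≡m+⌊n/2⌋ zero    n = refl
⌊m+m+n/2⌋≡m+⌊n/2⌋ (suc m) n rewrite +-suc m m = cong suc (⌊m+m+n/2⌋≡m+⌊n/2⌋ m n)

n∸⌈n/2⌉≡⌊n/2⌋ : ∀ n → n ∸ ⌈ n /2⌉ ≡ ⌊ n /2⌋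
n∸⌈n/2⌉≡⌊n/2⌋ n = trans (cong (_∸ ⌈ n /2⌉) (sym (⌊n/2⌋+⌈n/2⌉≡n n))) (m+n∸n≡m ⌊ n /2⌋ ⌈ n /2⌉)

m+n∸o≤m+[n∸o] : ∀ m n o → m + n ∸ o ≤ m + (n ∸ o)
m+n∸o≤m+[n∸o] m n o = m≤n+o⇒m∸n≤o (m + n) o (begin
  m + n              ≤⟨ +-monoʳ-≤ m (m≤n+m∸n n o) ⟩
  m + (o + (n ∸ o))  ≡⟨ +-assoc m o _ ⟨
  m + o + (n ∸ o)    ≡⟨ cong (_+ (n ∸ o)) (+-comm m o) ⟩
  o + m + (n ∸ o)    ≡⟨ +-assoc o m _ ⟩
  o + (m + (n ∸ o))  ∎)
  where open ≤-Reasoning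

⌊n+k/2⌋≤k+⌊N/2⌋ : ∀ {n k N} → n ≤ k + N → ⌊ n + k /2⌋ ≤ k + ⌊ N /2⌋
⌊n+k/2⌋≤k+⌊N/2⌋ {n} {k} {N} n≤k+N = begin
  ⌊ n + k /2⌋      ≤⟨ ⌊n/2⌋-mono (+-monoˡ-≤ k n≤k+N) ⟩
  ⌊ k + N + k /2⌋  ≡⟨ cong ⌊_/2⌋ (trans (+-comm (k + N) k) (sym (+-assoc k k N))) ⟩
  ⌊ k + k + N /2⌋  ≡⟨ ⌊m+m+n/2⌋≡m+⌊n/2⌋ k N ⟩
  k + ⌊ N /2⌋      ∎
  where open ≤-Reasoning

lowerBound-arith : ∀ {n k N n′} → n ≤ k + N → n′ ≤ n →
  ⌊ n + k /2⌋ ⊓ (n ∸ n′ + 1) ≤ k + (N ∸ ((n′ ∸ 1) ⊔ ⌈ N /2⌉))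
lowerBound-arith {n} {k} {N} {n′} n≤k+N n′≤n = begin
  ⌊ n + k /2⌋ ⊓ (n ∸ n′ + 1)                   ≤⟨ ⊓-glb (secondBound n′ n′≤n) firstBound ⟩
  (k + (N ∸ (n′ ∸ 1))) ⊓ (k + ⌊ N /2⌋)         ≡⟨ +-distribˡ-⊓ k _ _ ⟨
  k + ((N ∸ (n′ ∸ 1)) ⊓ ⌊ N /2⌋)               ≡⟨ cong (λ h → k + ((N ∸ (n′ ∸ 1)) ⊓ h)) (n∸⌈n/2⌉≡⌊n/2⌋ N) ⟨
  k + ((N ∸ (n′ ∸ 1)) ⊓ (N ∸ ⌈ N /2⌉))         ≡⟨ cong (k +_) (∸-distribˡ-⊔-⊓ N (n′ ∸ 1) ⌈ N /2⌉) ⟨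
  k + (N ∸ ((n′ ∸ 1) ⊔ ⌈ N /2⌉))               ∎
  where
  open ≤-Reasoning
  firstBound : ∀ {m} → ⌊ n + k /2⌋ ⊓ m ≤ k + ⌊ N /2⌋
  firstBound = ≤-trans (m⊓n≤m _ _) (⌊n+k/2⌋≤k+⌊N/2⌋ n≤k+N)
  -- For m = 0 the second term may exceed the bound, so the first one is used.
  secondBound : ∀ m → m ≤ n → ⌊ n + k /2⌋ ⊓ (n ∸ m + 1) ≤ k + (N ∸ (m ∸ 1))
  secondBound zero    _   = ≤-trans firstBound (+-monoʳ-≤ k (⌊n/2⌋≤n N))
  secondBound (suc b) b<n = begin
    ⌊ n + k /2⌋ ⊓ (n ∸ suc b + 1)  ≤⟨ m⊓n≤n _ _ ⟩
    n ∸ suc b + 1                  ≡⟨ +-comm (n ∸ suc b) 1 ⟩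
    1 + (n ∸ suc b)                ≡⟨ +-∸-assoc 1 b<n ⟨
    n ∸ b                          ≤⟨ ∸-monoˡ-≤ b n≤k+N ⟩
    k + N ∸ b                      ≤⟨ m+n∸o≤m+[n∸o] k N b ⟩
    k + (N ∸ b)                    ∎

module LowerBound {n k : ℕ} (c : Fin n → Fin k) (surj : Surjective c) where

  -- Matching on the membership proof as well rules out part c i ≡ [].
  head-and-rest : ∀ i → ∃₂ λ r rs → part c i ≡ r ∷ rs
  head-and-rest i with part c i | ∈-part⁺ c (proj₂ (surj i))
  ... | r ∷ rs | _ = r , rs , refl

  rep : Fin k → Fin n
  rep i = proj₁ (head-and-rest i)

  rest : Fin k → List (Fin n)
  rest i = proj₁ (proj₂ (head-and-rest i))

  part≡rep∷rest : ∀ i → part c i ≡ rep i ∷ rest i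
  part≡rep∷rest i = proj₂ (proj₂ (head-and-rest i))

  c-rep : ∀ i → c (rep i) ≡ i
  c-rep i = ∈-part⁻ c (subst (rep i ∈_) (sym (part≡rep∷rest i)) (here refl))

  rest-colour : ∀ i → All (λ v → c v ≡ i) (rest i)
  rest-colour i = All.tabulate λ v∈ → ∈-part⁻ c (subst (_ ∈_) (sym (part≡rep∷rest i)) (there v∈))

  rep∷rest-unique : ∀ i → Unique (rep i ∷ rest i)
  rep∷rest-unique i = subst Unique (part≡rep∷rest i) (part-unique c i)

  rest-unique : ∀ i → Unique (rest i)
  rest-unique i with rep∷rest-unique i
  ... | _ ∷ u = u

  rest-nonrep : ∀ i → All (λ v → v ≢ rep (c v)) (rest i)
  rest-nonrep i = All.tabulate λ {v} v∈ v≡rep →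
    Uniqueₚ.Unique[x∷xs]⇒x∉xs (rep∷rest-unique i)
      (subst (_∈ rest i) (trans v≡rep (cong rep (All.lookup (rest-colour i) v∈))) v∈)

  ∈-rest : ∀ {v} → v ≢ rep (c v) → v ∈ rest (c v)
  ∈-rest {v} v≢rep with subst (v ∈_) (part≡rep∷rest (c v)) (∈-part⁺ c refl)
  ... | here v≡rep = contradiction v≡rep v≢rep
  ... | there v∈   = v∈

  B : ℕ
  B = largestPart c ∸ 1

  length-rest≤B : ∀ i → length (rest i) ≤ B
  length-rest≤B i = ∸-monoˡ-≤ 1 (subst (_≤ largestPart c) (cong length (part≡rep∷rest i)) (partSize≤largestPart c i))

  L : List (Fin n)
  L = concatMap rest (allFin k)

  N : ℕ
  N = length L

  L-unique : Unique L
  L-unique = Uniqueₚ.concat⁺ (Allₚ.map⁺ (Allₚ.tabulate⁺ rest-unique))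
    (AllPairsₚ.map⁺ (AllPairs.map (λ i≢j {v} (v∈i , v∈j) →
      i≢j (trans (sym (All.lookup (rest-colour _) v∈i)) (All.lookup (rest-colour _) v∈j)))
      (Uniqueₚ.allFin⁺ k)))

  L-nonrep : All (λ v → v ≢ rep (c v)) L
  L-nonrep = Allₚ.concat⁺ (Allₚ.map⁺ (Allₚ.tabulate⁺ rest-nonrep))

  ∈-L : ∀ {v} → v ≢ rep (c v) → v ∈ L
  ∈-L v≢rep = ∈-concat⁺′ (∈-rest v≢rep) (∈-map⁺ rest (∈-allFin _))

  L-separated : Separated c B L
  L-separated = concatMap-separated c rest rest-colour length-rest≤B (Uniqueₚ.allFin⁺ k)

  s : ℕ
  s = B ⊔ ⌈ N /2⌉

  M : ℕ
  M = N ∸ s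

  M≤s : M ≤ s
  M≤s = begin
    N ∸ (B ⊔ ⌈ N /2⌉)  ≤⟨ ∸-monoʳ-≤ N (m≤n⊔m B ⌈ N /2⌉) ⟩
    N ∸ ⌈ N /2⌉        ≡⟨ n∸⌈n/2⌉≡⌊n/2⌋ N ⟩
    ⌊ N /2⌋            ≤⟨ ⌊n/2⌋≤⌈n/2⌉ N ⟩
    ⌈ N /2⌉            ≤⟨ m≤n⊔m B ⌈ N /2⌉ ⟩
    B ⊔ ⌈ N /2⌉        ∎
    where open ≤-Reasoning

  high<N : (j : Fin M) → toℕ j + s < N
  high<N j = m≤o∸n⇒m+n≤o (suc (toℕ j)) s≤N (toℕ<n j)
    where
    s≤N : s ≤ N
    s≤N = <⇒≤ (m∸n≢0⇒n<m (λ M≡0 → contradiction (subst (toℕ j <_) M≡0 (toℕ<n j)) λ ()))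

  low<N : (j : Fin M) → toℕ j < N
  low<N j = ≤-<-trans (m≤m+n (toℕ j) s) (high<N j)

  x y : Fin M → Fin n
  x j = proj₁ (nth-just {xs = L} (low<N j))
  y j = proj₁ (nth-just {xs = L} (high<N j))

  nth-x : ∀ j → nth L (toℕ j) ≡ just (x j)
  nth-x j = proj₂ (nth-just {xs = L} (low<N j))

  nth-y : ∀ j → nth L (toℕ j + s) ≡ just (y j)
  nth-y j = proj₂ (nth-just {xs = L} (high<N j))

  β : Fin n → Maybe (Fin k ⊎ Fin M)
  β v with v ≟ rep (c v)
  ... | yes _     = just (inj₁ (c v))
  ... | no v≢rep  = Maybe.map inj₂ (pairIndex M s (toℕ (index (∈-L v≢rep))))

  β-rep : ∀ i → β (rep i) ≡ just (inj₁ i)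
  β-rep i with rep i ≟ rep (c (rep i))
  ... | yes _    = cong (just ∘ inj₁) (c-rep i)
  ... | no r≢r   = contradiction (cong rep (sym (c-rep i))) r≢r

  β-inj₁ : ∀ {u i} → β u ≡ just (inj₁ i) → u ≡ rep i
  β-inj₁ {u} βu with u ≟ rep (c u)
  β-inj₁ refl | yes u≡rep = u≡rep
  β-inj₁ βu   | no u≢rep = contradiction βu (map-inj₂≢just-inj₁ (pairIndex M s (toℕ (index (∈-L u≢rep)))))
    where
    map-inj₂≢just-inj₁ : ∀ {i} m → Maybe.map inj₂ m ≢ just (inj₁ {B = Fin M} i)
    map-inj₂≢just-inj₁ nothing  ()
    map-inj₂≢just-inj₁ (just _) ()

  β-nth : ∀ {a v} → nth L a ≡ just v → β v ≡ Maybe.map inj₂ (pairIndex M s a)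
  β-nth {a} {v} hv with v ≟ rep (c v)
  ... | yes v≡rep = contradiction v≡rep (All.lookup L-nonrep (nth-∈ hv))
  ... | no v≢rep  = cong (Maybe.map inj₂ ∘ pairIndex M s) (nth-injective L-unique (nth-index (∈-L v≢rep)) hv)

  β-x : ∀ j → β (x j) ≡ just (inj₂ j)
  β-x j = trans (β-nth (nth-x j)) (cong (Maybe.map inj₂) (pairIndex-low M≤s j))

  β-y : ∀ j → β (y j) ≡ just (inj₂ j)
  β-y j = trans (β-nth (nth-y j)) (cong (Maybe.map inj₂) (pairIndex-high s j))

  -- Pair partners are s ≥ B positions apart.
  c-x≢c-y : ∀ j → c (x j) ≢ c (y j)
  c-x≢c-y j eq = ≤⇒≯ (m≤m⊔n B ⌈ N /2⌉) (L-separated (toℕ j) s (nth-x j) (nth-y j) eq)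

  minor : KMinor (completeMultipartite c) (k + M)
  minor = kMinor-⊎ (TransversalModel.model c β rep c-rep β-rep β-inj₁ x y β-x β-y c-x≢c-y)

  code : (v : Fin n) → Dec (v ≡ rep (c v)) → Fin k ⊎ Fin N
  code v (yes _)      = inj₁ (c v)
  code v (no v≢rep)   = inj₂ (index (∈-L v≢rep))

  code-injective : ∀ u v du dv → code u du ≡ code v dv → u ≡ v
  code-injective u v (yes u≡rep) (yes v≡rep) eq = trans u≡rep (trans (cong rep (inj₁-injective eq)) (sym v≡rep))
  code-injective u v (no u≢rep)  (no v≢rep)  eq = begin
    u                              ≡⟨ lookup-index (∈-L u≢rep) ⟩
    lookup L (index (∈-L u≢rep))   ≡⟨ cong (lookup L) (inj₂-injective eq) ⟩
    lookup L (index (∈-L v≢rep))   ≡⟨ lookup-index (∈-L v≢rep) ⟨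
    v                              ∎
    where open ≡-Reasoning

  n≤k+N : n ≤ k + N
  n≤k+N = injective⇒≤-⊎ {f = λ v → code v (v ≟ rep (c v))} (code-injective _ _ _ _)

theorem8 : (n k : ℕ) (c : Fin n → Fin k) → Surjective c →
    HadwigerNumber (completeMultipartite c) (⌊ n + k /2⌋ ⊓ (n ∸ largestPart c + 1))
theorem8 n k c surj =
  kMinor-≤ (lowerBound-arith n≤k+N (largestPart≤n c)) minor ,
  λ t K → ⊓-glb (UpperBound.t≤⌊n+k/2⌋ c K) (UpperBound.t≤n∸largestPart+1 c K)
  where open LowerBound c surj
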